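{- Let $E=(e_X,e_Y,R)$ be an extension polarity extending the poset $P$. The following are equivalent: (1) $E$ is 2-coherent; (2) $\preceq_1$ is a 2-preorder for $E$; (3) there exists a 2-preorder for $E$. Moreover, the set of 2-preorders for $E$ is closed under non-empty intersections and, if it is non-empty, has $\preceq_1$ as its smallest member; and in this case ${\le_X}=Z_X$ and ${\le_Y}=Z_Y$.
   Context: An extension polarity is a triple $(e_X,e_Y,R)$ where $P$ is a poset, $X,Y$ are disjoint posets, $e_X:P\to X$ and $e_Y:P\to Y$ are order embeddings, and $R\subseteq X\times Y$. Coherence conditions: (C1) for all $x_1,x_2\in X$, $y\in Y$: if $x_1\le_X x_2$ and $x_2\mathrel{R}y$ then $x_1\mathrel{R}y$. (C2) for all $y_1,y_2\in Y$, $x\in X$: if $y_1\le_Y y_2$ and $x\mathrel{R}y_1$ then $x\mathrel{R}y_2$. (C3) for all $p\in P$: $e_X(p)\mathrel{R}e_Y(p)$. (C4) for all $p,x,y$: if $x\mathrel{R}e_Y(p)$ and $e_X(p)\mathrel{R}y$ then $x\mathrel{R}y$. (C5) for all $x_1,x_2\in X$, $p\in P$: if $x_1\mathrel{R}e_Y(p)$ and $e_X(p)\le_X x_2$ then $x_1\le_X x_2$. (C6) for all $y_1,y_2\in Y$, $p\in P$: if $y_1\le_Y e_Y(p)$ and $e_X(p)\mathrel{R}y_2$ then $y_1\le_Y y_2$. $E$ is 2-coherent if it satisfies (C1)–(C6). For a preorder $\preceq$ on $X\cup Y$, let $X\uplus_\preceq Y$ be the quotient poset (identify $z_1,z_2$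 when $z_1\preceq z_2\preceq z_1$) and $\iota_X,\iota_Y$ the inclusions composed with the quotient map. A 0-preorder for $E$ is a preorder $\preceq$ on $X\cup Y$ with: $x\preceq y\iff x\mathrel{R}y$ for $x\in X,y\in Y$; ${\le_X}\subseteq{\preceq}$; ${\le_Y}\subseteq{\preceq}$. A 1-preorder is a 0-preorder with $\iota_X\circ e_X=\iota_Y\circ e_Y$. A 2-preorder is a 1-preorder for which $\iota_X$ and $\iota_Y$ are order embeddings. $\preceq_1$ is the union of $R$ with $Z_X=\{(x_1,x_2)\in X^2:\exists p\in P\,(x_1\mathrel{R}e_Y(p)\text{ and }e_X(p)\le_X x_2)\}\cup{\le_X}$, $Z_Y=\{(y_1,y_2)\in Y^2:\exists p\in P\,(y_1\le_Y e_Y(p)\text{ and }e_X(p)\mathrel{R}y_2)\}\cup{\le_Y}$, $Z_{YX}=\{(y,x)\in Y\times X:\exists p,q\in P\,(y\le_Y e_Y(p),\ e_X(p)\mathrel{R}e_Y(q),\ e_X(q)\le_X x)\}$. -}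

module Defs where

open import Level using (Level; suc; _⊔_)
open import Data.Product using (_×_; _,_; ∃; ∃-syntax; Σ-syntax)
open import Data.Sum using (_⊎_; inj₁; inj₂)
open import Relation.Binary.Bundles using (Poset)
open import Relation.Binary.Core using (Rel; _⇒_)
open import Relation.Binary.Definitions using (Reflexive; Transitive)

record IsOrderEmbedding {ℓ} (A B : Poset ℓ ℓ ℓ)
    (f : Poset.Carrier A → Poset.Carrier B) : Set ℓ where
  field
    monotone   : ∀ {a b} → Poset._≤_ A a b → Poset._≤_ B (f a) (f b)
    reflecting : ∀ {a b} → Poset._≤_ B (f a) (f b) → Poset._≤_ A a b

-- An extension polarity (e_X, e_Y, R) extending P.  X and Y are disjoint
-- by working with the disjoint union X ⊎ Y below.
record ExtensionPolarity (ℓ : Level) : Set (suc ℓ) where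
  field
    P X Y : Poset ℓ ℓ ℓ
  module P = Poset P
  module X = Poset X
  module Y = Poset Y
  field
    eX : P.Carrier → X.Carrier
    eY : P.Carrier → Y.Carrier
    eX-emb : IsOrderEmbedding P X eX
    eY-emb : IsOrderEmbedding P Y eY
    R : X.Carrier → Y.Carrier → Set ℓ

module _ {ℓ} (E : ExtensionPolarity ℓ) where
  open ExtensionPolarity E

  C1 C2 C3 C4 C5 C6 : Set ℓ
  C1 = ∀ {x₁ x₂ y} → x₁ X.≤ x₂ → R x₂ y → R x₁ y
  C2 = ∀ {y₁ y₂ x} → y₁ Y.≤ y₂ → R x y₁ → R x y₂
  C3 = ∀ p → R (eX p) (eY p)
  C4 = ∀ {p x y} → R x (eY p) → R (eX p) y → R x y
  C5 = ∀ {x₁ x₂ p} → R x₁ (eY p) → eX p X.≤ x₂ → x₁ X.≤ x₂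
  C6 = ∀ {y₁ y₂ p} → y₁ Y.≤ eY p → R (eX p) y₂ → y₁ Y.≤ y₂

  2-coherent : Set ℓ
  2-coherent = C1 × C2 × C3 × C4 × C5 × C6

  Carrier⊎ : Set ℓ
  Carrier⊎ = X.Carrier ⊎ Y.Carrier

  IsPreorderOn : Rel Carrier⊎ ℓ → Set ℓ
  IsPreorderOn _≼_ = Reflexive _≼_ × Transitive _≼_

  Is0Preorder : Rel Carrier⊎ ℓ → Set ℓ
  Is0Preorder _≼_ =
    IsPreorderOn _≼_
    × (∀ x y → (inj₁ x ≼ inj₂ y → R x y) × (R x y → inj₁ x ≼ inj₂ y))
    × (∀ {x₁ x₂} → x₁ X.≤ x₂ → inj₁ x₁ ≼ inj₁ x₂)
    × (∀ {y₁ y₂} → y₁ Y.≤ y₂ → inj₂ y₁ ≼ inj₂ y₂)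

  -- ι_X ∘ e_X = ι_Y ∘ e_Y in the quotient poset X ⊎_≼ Y means that
  -- e_X p and e_Y p are ≼-equivalent.
  Is1Preorder : Rel Carrier⊎ ℓ → Set ℓ
  Is1Preorder _≼_ = Is0Preorder _≼_
    × (∀ p → (inj₁ (eX p) ≼ inj₂ (eY p)) × (inj₂ (eY p) ≼ inj₁ (eX p)))

  -- ι_X, ι_Y order embeddings into the quotient poset: the quotient order
  -- on classes [z₁] ≤ [z₂] is z₁ ≼ z₂.
  Is2Preorder : Rel Carrier⊎ ℓ → Set ℓ
  Is2Preorder _≼_ = Is1Preorder _≼_
    × (∀ {x₁ x₂} → inj₁ x₁ ≼ inj₁ x₂ → x₁ X.≤ x₂)
    × (∀ {y₁ y₂} → inj₂ y₁ ≼ inj₂ y₂ → y₁ Y.≤ y₂)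

  Z-X : Rel X.Carrier ℓ
  Z-X x₁ x₂ = (∃[ p ] (R x₁ (eY p) × eX p X.≤ x₂)) ⊎ (x₁ X.≤ x₂)

  Z-Y : Rel Y.Carrier ℓ
  Z-Y y₁ y₂ = (∃[ p ] (y₁ Y.≤ eY p × R (eX p) y₂)) ⊎ (y₁ Y.≤ y₂)

  Z-YX : Y.Carrier → X.Carrier → Set ℓ
  Z-YX y x = ∃[ p ] ∃[ q ] (y Y.≤ eY p × R (eX p) (eY q) × eX q X.≤ x)

  ≼₁ : Rel Carrier⊎ ℓ
  ≼₁ (inj₁ x₁) (inj₁ x₂) = Z-X x₁ x₂
  ≼₁ (inj₁ x)  (inj₂ y)  = R x y
  ≼₁ (inj₂ y)  (inj₁ x)  = Z-YX y x
  ≼₁ (inj₂ y₁) (inj₂ y₂) = Z-Y y₁ y₂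

  ⋂ : {I : Set ℓ} → (I → Rel Carrier⊎ ℓ) → Rel Carrier⊎ ℓ
  ⋂ {I} F a b = ∀ (i : I) → F i a b

  _≐_ : ∀ {A : Set ℓ} → Rel A ℓ → Rel A ℓ → Set ℓ
  S ≐ T = (S ⇒ T) × (T ⇒ S)

  ≤X : Rel X.Carrier ℓ
  ≤X = X._≤_

  ≤Y : Rel Y.Carrier ℓ
  ≤Y = Y._≤_

-- A 2-preorder ≼ forces e_Y p ≼ e_X p, so every chain
-- x R e_Y p, e_X p ≤ x' (and its Y- and Y×X-analogues) lies in ≼; hence ≼₁ ⊆ ≼,
-- and reading these chains back through the defining properties of a
-- 2-preorder yields the coherence conditions (C1)–(C6).  Conversely (C5) and
-- (C6) collapse Z_X and Z_Y onto ≤_X and ≤_Y, after which transitivity of ≼₁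
-- is a case analysis on the sides of the three points, with (C4) gluing two
-- R-steps through e_Y q ≼ e_X q.
module Submission where

open import Defs
open import Level using (Level)
open import Data.Product using (_×_; ∃-syntax; _,_; proj₁; proj₂)
open import Data.Sum using (inj₁; inj₂)
open import Relation.Binary.Core using (Rel; _⇒_)
open import Relation.Binary.Definitions using (Reflexive; Transitive)

module _ {ℓ : Level} (E : ExtensionPolarity ℓ) where
  open ExtensionPolarity E

  module Coherent (coh : 2-coherent E) where
    private
      c₁ : C1 E
      c₁ = coh .proj₁
      c₂ : C2 E
      c₂ = coh .proj₂ .proj₁
      c₃ : C3 E
      c₃ = coh .proj₂ .proj₂ .proj₁
      c₄ : C4 E
      c₄ = coh .proj₂ .proj₂ .proj₂ .proj₁
      c₅ : C5 E
      c₅ = coh .proj₂ .proj₂ .proj₂ .proj₂ .proj₁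
      c₆ : C6 E
      c₆ = coh .proj₂ .proj₂ .proj₂ .proj₂ .proj₂

    Z-X⇒≤X : Z-X E ⇒ ≤X E
    Z-X⇒≤X (inj₁ (_ , x₁Rp , p≤x₂)) = c₅ x₁Rp p≤x₂
    Z-X⇒≤X (inj₂ x₁≤x₂)             = x₁≤x₂

    Z-Y⇒≤Y : Z-Y E ⇒ ≤Y E
    Z-Y⇒≤Y (inj₁ (_ , y₁≤p , pRy₂)) = c₆ y₁≤p pRy₂
    Z-Y⇒≤Y (inj₂ y₁≤y₂)             = y₁≤y₂

    ≼₁-refl : Reflexive (≼₁ E)
    ≼₁-refl {inj₁ _} = inj₂ X.refl
    ≼₁-refl {inj₂ _} = inj₂ Y.refl

    ≼₁-trans : Transitive (≼₁ E)
    ≼₁-trans {inj₁ _} {inj₁ _} {inj₁ _} u v = inj₂ (X.trans (Z-X⇒≤X u) (Z-X⇒≤X v))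
    ≼₁-trans {inj₁ _} {inj₁ _} {inj₂ _} u v = c₁ (Z-X⇒≤X u) v
    ≼₁-trans {inj₁ _} {inj₂ _} {inj₂ _} u v = c₂ (Z-Y⇒≤Y v) u
    ≼₁-trans {inj₂ _} {inj₂ _} {inj₂ _} u v = inj₂ (Y.trans (Z-Y⇒≤Y u) (Z-Y⇒≤Y v))
    ≼₁-trans {inj₁ _} {inj₂ _} {inj₁ _} u (_ , q , y≤p , pRq , q≤x) =
      inj₁ (q , c₄ (c₂ y≤p u) pRq , q≤x)
    ≼₁-trans {inj₂ _} {inj₁ _} {inj₂ _} (p , _ , y≤p , pRq , q≤x) v =
      inj₁ (p , y≤p , c₄ pRq (c₁ q≤x v))
    ≼₁-trans {inj₂ _} {inj₁ _} {inj₁ _} (p , q , y≤p , pRq , q≤x) v =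
      p , q , y≤p , pRq , X.trans q≤x (Z-X⇒≤X v)
    ≼₁-trans {inj₂ _} {inj₂ _} {inj₁ _} u (p , q , y≤p , pRq , q≤x) =
      p , q , Y.trans (Z-Y⇒≤Y u) y≤p , pRq , q≤x

    ≼₁-is2Preorder : Is2Preorder E (≼₁ E)
    ≼₁-is2Preorder =
      ( ( ((λ {z} → ≼₁-refl {z}) , (λ {a} {b} {c} → ≼₁-trans {a} {b} {c}))
        , (λ _ _ → (λ xRy → xRy) , (λ xRy → xRy))
        , inj₂
        , inj₂ )
      , (λ p → c₃ p , (p , p , Y.refl , c₃ p , X.refl)) )
      , Z-X⇒≤X
      , Z-Y⇒≤Y

  module 2-Preorder (_≼_ : Rel (Carrier⊎ E) ℓ) (h : Is2Preorder E _≼_) where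
    ≼-refl : Reflexive _≼_
    ≼-refl = h .proj₁ .proj₁ .proj₁ .proj₁

    ≼-trans : Transitive _≼_
    ≼-trans = h .proj₁ .proj₁ .proj₁ .proj₂

    ≼⇒R : ∀ {x y} → inj₁ x ≼ inj₂ y → R x y
    ≼⇒R {x} {y} = h .proj₁ .proj₁ .proj₂ .proj₁ x y .proj₁

    R⇒≼ : ∀ {x y} → R x y → inj₁ x ≼ inj₂ y
    R⇒≼ {x} {y} = h .proj₁ .proj₁ .proj₂ .proj₁ x y .proj₂

    ≤X⇒≼ : ∀ {x₁ x₂} → x₁ X.≤ x₂ → inj₁ x₁ ≼ inj₁ x₂
    ≤X⇒≼ = h .proj₁ .proj₁ .proj₂ .proj₂ .proj₁

    ≤Y⇒≼ : ∀ {y₁ y₂} → y₁ Y.≤ y₂ → inj₂ y₁ ≼ inj₂ y₂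
    ≤Y⇒≼ = h .proj₁ .proj₁ .proj₂ .proj₂ .proj₂

    eX≼eY : ∀ p → inj₁ (eX p) ≼ inj₂ (eY p)
    eX≼eY p = h .proj₁ .proj₂ p .proj₁

    eY≼eX : ∀ p → inj₂ (eY p) ≼ inj₁ (eX p)
    eY≼eX p = h .proj₁ .proj₂ p .proj₂

    ≼⇒≤X : ∀ {x₁ x₂} → inj₁ x₁ ≼ inj₁ x₂ → x₁ X.≤ x₂
    ≼⇒≤X = h .proj₂ .proj₁

    ≼⇒≤Y : ∀ {y₁ y₂} → inj₂ y₁ ≼ inj₂ y₂ → y₁ Y.≤ y₂
    ≼⇒≤Y = h .proj₂ .proj₂

    ≼-trans-via : ∀ {a b} p → a ≼ inj₂ (eY p) → inj₁ (eX p) ≼ b → a ≼ b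
    ≼-trans-via p a≼p p≼b = ≼-trans a≼p (≼-trans (eY≼eX p) p≼b)

    2-coherent-of-2Preorder : 2-coherent E
    2-coherent-of-2Preorder =
        (λ x₁≤x₂ x₂Ry → ≼⇒R (≼-trans (≤X⇒≼ x₁≤x₂) (R⇒≼ x₂Ry)))
      , (λ y₁≤y₂ xRy₁ → ≼⇒R (≼-trans (R⇒≼ xRy₁) (≤Y⇒≼ y₁≤y₂)))
      , (λ p → ≼⇒R (eX≼eY p))
      , (λ {p} xRp pRy → ≼⇒R (≼-trans-via p (R⇒≼ xRp) (R⇒≼ pRy)))
      , (λ {_} {_} {p} x₁Rp p≤x₂ → ≼⇒≤X (≼-trans-via p (R⇒≼ x₁Rp) (≤X⇒≼ p≤x₂)))
      , (λ {_} {_} {p} y₁≤p pRy₂ → ≼⇒≤Y (≼-trans-via p (≤Y⇒≼ y₁≤p) (R⇒≼ pRy₂)))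

    ≼₁⊆≼ : ≼₁ E ⇒ _≼_
    ≼₁⊆≼ {inj₁ _} {inj₁ _} (inj₁ (p , x₁Rp , p≤x₂)) = ≼-trans-via p (R⇒≼ x₁Rp) (≤X⇒≼ p≤x₂)
    ≼₁⊆≼ {inj₁ _} {inj₁ _} (inj₂ x₁≤x₂)             = ≤X⇒≼ x₁≤x₂
    ≼₁⊆≼ {inj₁ _} {inj₂ _} xRy                      = R⇒≼ xRy
    ≼₁⊆≼ {inj₂ _} {inj₂ _} (inj₁ (p , y₁≤p , pRy₂)) = ≼-trans-via p (≤Y⇒≼ y₁≤p) (R⇒≼ pRy₂)
    ≼₁⊆≼ {inj₂ _} {inj₂ _} (inj₂ y₁≤y₂)             = ≤Y⇒≼ y₁≤y₂
    ≼₁⊆≼ {inj₂ _} {inj₁ _} (p , q , y≤p , pRq , q≤x) =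
      ≼-trans-via p (≤Y⇒≼ y≤p) (≼-trans-via q (R⇒≼ pRq) (≤X⇒≼ q≤x))

  -- The index i₀ is used only to reflect ≼ back into R, ≤_X and ≤_Y:
  -- the empty intersection is the total relation.
  ⋂-is2Preorder : ∀ (I : Set ℓ) (F : I → Rel (Carrier⊎ E) ℓ) → I →
                  (∀ i → Is2Preorder E (F i)) → Is2Preorder E (⋂ E F)
  ⋂-is2Preorder I F i₀ h =
    ( ( ( (λ i → 2-Preorder.≼-refl (F i) (h i))
        , (λ u v i → 2-Preorder.≼-trans (F i) (h i) (u i) (v i)) )
      , (λ _ _ → (λ u → 2-Preorder.≼⇒R (F i₀) (h i₀) (u i₀))
               , (λ xRy i → 2-Preorder.R⇒≼ (F i) (h i) xRy))
      , (λ x₁≤x₂ i → 2-Preorder.≤X⇒≼ (F i) (h i) x₁≤x₂)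
      , (λ y₁≤y₂ i → 2-Preorder.≤Y⇒≼ (F i) (h i) y₁≤y₂) )
    , (λ p → (λ i → 2-Preorder.eX≼eY (F i) (h i) p)
           , (λ i → 2-Preorder.eY≼eX (F i) (h i) p)) )
    , (λ u → 2-Preorder.≼⇒≤X (F i₀) (h i₀) (u i₀))
    , (λ u → 2-Preorder.≼⇒≤Y (F i₀) (h i₀) (u i₀))

theorem3p14 : ∀ {ℓ : Level} (E : ExtensionPolarity ℓ) →
    -- (1) ⇒ (2) ⇒ (3) ⇒ (1)
    ((2-coherent E → Is2Preorder E (≼₁ E))
      × (Is2Preorder E (≼₁ E) → ∃[ ≼ ] Is2Preorder E ≼)
      × ((∃[ ≼ ] Is2Preorder E ≼) → 2-coherent E))
    -- closure under non-empty intersections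
    × (∀ (I : Set ℓ) (F : I → Rel (Carrier⊎ E) ℓ) → I →
         (∀ i → Is2Preorder E (F i)) → Is2Preorder E (⋂ E F))
    -- if non-empty: ≼₁ is the least 2-preorder, ≤_X = Z_X and ≤_Y = Z_Y
    × ((∃[ ≼ ] Is2Preorder E ≼) →
         Is2Preorder E (≼₁ E)
         × (∀ (≼ : Rel (Carrier⊎ E) ℓ) → Is2Preorder E ≼ → ≼₁ E ⇒ ≼)
         × _≐_ E (≤X E) (Z-X E)
         × _≐_ E (≤Y E) (Z-Y E))
theorem3p14 E =
    ( Coherent.≼₁-is2Preorder E
    , (λ h → ≼₁ E , h)
    , (λ (≼ , h) → 2-Preorder.2-coherent-of-2Preorder E ≼ h) )
  , ⋂-is2Preorder E
  , λ (≼ , h) →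
      let coh = 2-Preorder.2-coherent-of-2Preorder E ≼ h
          open Coherent E coh
      in  ≼₁-is2Preorder
        , (λ ≼′ h′ → 2-Preorder.≼₁⊆≼ E ≼′ h′)
        , (inj₂ , Z-X⇒≤X)
        , (inj₂ , Z-Y⇒≤Y)
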